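{- Let $\Lambda$ be a linear order, $\alpha\in|\Lambda|$ and $A$ a worm. If $\mathsf{GLP}_\Lambda\vdash A\to\langle\alpha\rangle A$, then $\mathsf{GLP}_\Lambda\vdash\neg A$.
   Context: $\mathsf{GLP}_\Lambda$ (for a linear order $\Lambda$) is the modal logic with modalities $[\alpha]$, $\alpha\in|\Lambda|$, $\langle\alpha\rangle:=\neg[\alpha]\neg$, axiomatized by propositional tautologies and, for all $\alpha,\beta$: (i) $[\alpha](\chi\to\psi)\to([\alpha]\chi\to[\alpha]\psi)$; (ii) $[\alpha]([\alpha]\chi\to\chi)\to[\alpha]\chi$; (iii) $[\alpha]\chi\to[\beta][\alpha]\chi$ for $\alpha\le\beta$; (iv) $\langle\alpha\rangle\chi\to[\beta]\langle\alpha\rangle\chi$ for $\alpha<\beta$; (v) $[\alpha]\chi\to[\beta]\chi$ for $\alpha\le\beta$; with modus ponens and necessitation. A worm is a formula $\langle\alpha_1\rangle\cdots\langle\alpha_n\rangle\top$ with $n\ge0$ and $\alpha_i\in|\Lambda|$. -}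

module Defs where

open import Level using (Level; _⊔_)
open import Data.Nat using (ℕ)
open import Data.List using (List; []; _∷_)
open import Data.Sum using (_⊎_)
open import Data.Bool using (Bool; true; false)
open import Relation.Binary.PropositionalEquality using (_≡_)
open import Relation.Binary.Bundles using (StrictTotalOrder)

module GLP {a ℓ₁ ℓ₂ : Level} (Λ : StrictTotalOrder a ℓ₁ ℓ₂) where
  open StrictTotalOrder Λ renaming (Carrier to Ord)

  _≤Λ_ : Ord → Ord → Set (ℓ₁ ⊔ ℓ₂)
  α ≤Λ β = α < β ⊎ α ≈ β

  infixr 5 _⇒_

  data Fm : Set a where
    var : ℕ → Fm
    ⊥'  : Fm
    _⇒_ : Fm → Fm → Fm
    [_]_ : Ord → Fm → Fm

  ¬' : Fm → Fm
  ¬' φ = φ ⇒ ⊥'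

  ⊤' : Fm
  ⊤' = ¬' ⊥'

  ⟨_⟩_ : Ord → Fm → Fm
  ⟨ α ⟩ φ = ¬' ([ α ] (¬' φ))

  impB : Bool → Bool → Bool
  impB true false = false
  impB _    _     = true

  -- a valuation assigns truth values to variables and to boxed formulas
  -- (boxed formulas are treated as propositional atoms)
  eval : (ℕ → Bool) → (Ord → Fm → Bool) → Fm → Bool
  eval v b (var n)   = v n
  eval v b ⊥'        = false
  eval v b (φ ⇒ ψ)   = impB (eval v b φ) (eval v b ψ)
  eval v b ([ α ] φ) = b α φ

  Tautology : Fm → Set a
  Tautology φ = ∀ (v : ℕ → Bool) (b : Ord → Fm → Bool) → eval v b φ ≡ true

  data ⊢_ : Fm → Set (a ⊔ ℓ₁ ⊔ ℓ₂) where
    taut : ∀ {φ} → Tautology φ → ⊢ φ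
    axK  : ∀ {α χ ψ} → ⊢ ([ α ] (χ ⇒ ψ) ⇒ ([ α ] χ ⇒ [ α ] ψ))
    axL  : ∀ {α χ} → ⊢ ([ α ] ([ α ] χ ⇒ χ) ⇒ [ α ] χ)
    ax3  : ∀ {α β χ} → α ≤Λ β → ⊢ ([ α ] χ ⇒ [ β ] ([ α ] χ))
    ax4  : ∀ {α β χ} → α < β → ⊢ (⟨ α ⟩ χ ⇒ [ β ] (⟨ α ⟩ χ))
    ax5  : ∀ {α β χ} → α ≤Λ β → ⊢ ([ α ] χ ⇒ [ β ] χ)
    mp   : ∀ {φ ψ} → ⊢ (φ ⇒ ψ) → ⊢ φ → ⊢ ψ
    nec  : ∀ {α φ} → ⊢ φ → ⊢ ([ α ] φ)

  worm : List Ord → Fm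
  worm []       = ⊤'
  worm (α ∷ αs) = ⟨ α ⟩ worm αs

-- Since ⟨α⟩A is ¬[α]¬A, the hypothesis contraposes to ⊢ [α]¬A → ¬A, and Löb's rule
-- turns that into ⊢ ¬A. Nothing about worms is used: the argument works for every formula.
module Submission where

open import Defs
open import Level using (Level)
open import Data.List using (List)
open import Function using (_∘_)
open import Data.Bool using (true; false)
open import Relation.Binary.PropositionalEquality using (_≡_; refl)
open import Relation.Binary.Bundles using (StrictTotalOrder)

module GLPProperties {a ℓ₁ ℓ₂ : Level} (Λ : StrictTotalOrder a ℓ₁ ℓ₂) where
  open GLP Λ
  open StrictTotalOrder Λ using () renaming (Carrier to Ord)

  impB-contrapose-¬ : ∀ x y → impB (impB x (impB y false)) (impB y (impB x false)) ≡ true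
  impB-contrapose-¬ true  true  = refl
  impB-contrapose-¬ true  false = refl
  impB-contrapose-¬ false true  = refl
  impB-contrapose-¬ false false = refl

  contrapose-¬ : ∀ {φ ψ} → ⊢ (φ ⇒ ¬' ψ) → ⊢ (ψ ⇒ ¬' φ)
  contrapose-¬ {φ} {ψ} = mp (taut λ v b → impB-contrapose-¬ (eval v b φ) (eval v b ψ))

  löb-rule : ∀ {α φ} → ⊢ ([ α ] φ ⇒ φ) → ⊢ φ
  löb-rule ⊢□φ⇒φ = mp ⊢□φ⇒φ (mp axL (nec ⊢□φ⇒φ))

  ¬-of-⇒⟨⟩-self : ∀ (α : Ord) φ → ⊢ (φ ⇒ ⟨ α ⟩ φ) → ⊢ ¬' φ
  ¬-of-⇒⟨⟩-self α φ = löb-rule ∘ contrapose-¬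

mainTheorem13 : {a ℓ₁ ℓ₂ : Level} (Λ : StrictTotalOrder a ℓ₁ ℓ₂) →
    let open GLP Λ in
    (α : StrictTotalOrder.Carrier Λ) (A : List (StrictTotalOrder.Carrier Λ)) →
    ⊢ (worm A ⇒ ⟨ α ⟩ worm A) → ⊢ ¬' (worm A)
mainTheorem13 Λ α A = GLPProperties.¬-of-⇒⟨⟩-self Λ α (GLP.worm Λ A)
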